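{- Let $q\ge5$ be prime, $q^*=(-1)^{(q-1)/2}q$, $u_q(j)=(3^j-q^*(-1)^j)/4$, and let $D_q(n)$ be the smallest positive integer $m$ such that $u_q(1),\ldots,u_q(n)$ are pairwise incongruent modulo $m$. Then $$D_q(5)=\begin{cases}7 & \text{if } q=7 \text{ or } q\equiv\pm1\pmod{28};\\ 8 & \text{otherwise,}\end{cases}\qquad D_q(6)=\begin{cases}7 & \text{if } q=7;\\ 8 & \text{otherwise.}\end{cases}$$ -}

module Defs where

open import Data.Nat as ℕ using (ℕ; zero; suc; _≤_; _<_)
open import Data.Nat.Primality using (Prime)
open import Data.Integer as ℤ using (ℤ; +_; -_; _-_; _*_)
open import Data.Integer.DivMod using (_/ℕ_)
open import Data.Integer.Divisibility using (_∣_)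
open import Relation.Binary.PropositionalEquality using (_≡_)
open import Relation.Nullary using (¬_)

neg1^ : ℕ → ℤ
neg1^ zero = + 1
neg1^ (suc k) = - neg1^ k

qstar : ℕ → ℤ
qstar q = neg1^ ((q ℕ.∸ 1) ℕ./ 2) * + q

-- u_q(j) = (3^j - q* (-1)^j) / 4   (division is exact for odd q)
u : ℕ → ℕ → ℤ
u q j = (+ (3 ℕ.^ j) - qstar q * neg1^ j) /ℕ 4

Incongruent : ℕ → ℕ → ℕ → Set
Incongruent q n m = ∀ i j → 1 ≤ i → i ≤ n → 1 ≤ j → j ≤ n →
  (+ m) ∣ (u q i - u q j) → i ≡ j

IsD : ℕ → ℕ → ℕ → Set
IsD q n m = (1 ≤ m) × Incongruent q n m × (∀ k → 1 ≤ k → k < m → ¬ Incongruent q n k)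
  where open import Data.Product using (_×_)

-- Write q = r + 4L with r odd. Then (-1)^((q-1)/2) = (-1)^((r-1)/2) =: χ₄ r, and
-- u_q(j) = u_r(j) - χ₄ r · L · (-1)^j, so u_q(i) - u_q(j) ≡ u_r(i) - u_r(j) (mod m) whenever m ∣ L.
-- Hence whether u_q(1), …, u_q(n) are pairwise incongruent modulo m depends only on q mod 4m,
-- and everything reduces to evaluating finitely many odd residues: every modulus m ≤ 6 fails,
-- m = 8 always works, and m = 7 works for n = 5 iff q ≡ ±1, ±7 (mod 28) and for n = 6 iff
-- q ≡ ±7 (mod 28); for prime q the residues ±7 occur only when q = 7.
module Submission where

open import Defs
open import Data.Nat as ℕ using (ℕ; zero; suc; _≤_; _<_; _%_; NonZero; s≤s; z≤n)
import Data.Nat.Properties as ℕ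
import Data.Nat.DivMod as ℕ
import Data.Nat.Divisibility as ℕ
import Data.Nat.Tactic.RingSolver as ℕ-Solver
open import Data.Nat.Primality using (Prime; prime⇒irreducible)
open import Data.Integer as ℤ using (ℤ; +_; -_; _-_; _+_; _*_; ∣_∣; _⊖_)
open import Data.Integer.DivMod using (_/ℕ_; _%ℕ_; a≡a%ℕn+[a/ℕn]*n; n%ℕd<d)
open import Data.Integer.Properties as ℤ using (abs-*; m-n≡m⊖n; ∣m⊝n∣≤m⊔n; i-j≡0⇒i≡j; ∣i∣≡0⇒i≡0)
open import Data.Integer.Tactic.RingSolver using (solve-∀)
open import Data.Integer.Divisibility using (_∣_)
import Data.Integer.Divisibility.Signed as Signed
open import Data.Product using (_×_; _,_)
open import Data.Sum using (_⊎_; inj₁; inj₂)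
open import Function.Base using (_∘_)
open import Function.Bundles using (_⇔_; mk⇔; Equivalence)
open import Relation.Binary.PropositionalEquality
open import Relation.Nullary using (¬_; Dec; map′; ¬?)
open import Relation.Nullary.Decidable using (_→-dec_; _⊎-dec_; from-yes)
open Equivalence using (to; from)

/ℕ-unique : ∀ {n z r d} .{{_ : NonZero d}} → r < d → n ≡ + r + z * + d → n /ℕ d ≡ z
/ℕ-unique {n} {z} {r} {d} r<d n≡r+zd = sym (i-j≡0⇒i≡j z Q (∣i∣≡0⇒i≡0 (ℕ.n<1⇒n≡0 ∣z-Q∣<1)))
  where
  Q : ℤ
  Q = n /ℕ d
  s : ℕ
  s = n %ℕ d
  n≡s+Qd : n ≡ + s + Q * + d
  n≡s+Qd = a≡a%ℕn+[a/ℕn]*n n d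

  scaled : (z - Q) * + d ≡ s ⊖ r
  scaled = begin
    (z - Q) * + d                   ≡⟨ regroup (+ r) z Q (+ d) ⟩
    (+ r + z * + d) - + r - Q * + d ≡⟨ cong (λ x → x - + r - Q * + d) (trans (sym n≡r+zd) n≡s+Qd) ⟩
    (+ s + Q * + d) - + r - Q * + d ≡⟨ cancel (+ s) (+ r) Q (+ d) ⟩
    + s - + r                       ≡⟨ m-n≡m⊖n s r ⟩
    s ⊖ r                           ∎
    where
    open ≡-Reasoning
    regroup : ∀ a x y e → (x - y) * e ≡ (a + x * e) - a - y * e
    regroup = solve-∀
    cancel : ∀ a b y e → (a + y * e) - b - y * e ≡ a - b
    cancel = solve-∀

  ∣z-Q∣<1 : ∣ z - Q ∣ < 1
  ∣z-Q∣<1 = ℕ.*-cancelʳ-< d ∣ z - Q ∣ 1 (begin-strict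
    ∣ z - Q ∣ ℕ.* d   ≡⟨ abs-* (z - Q) (+ d) ⟨
    ∣ (z - Q) * + d ∣ ≡⟨ cong ∣_∣ scaled ⟩
    ∣ s ⊖ r ∣         ≤⟨ ∣m⊝n∣≤m⊔n s r ⟩
    s ℕ.⊔ r           <⟨ ℕ.⊔-lub (n%ℕd<d n d) r<d ⟩
    d                 ≡⟨ ℕ.*-identityˡ d ⟨
    1 ℕ.* d           ∎)
    where open ℕ.≤-Reasoning

[i+j*d]/ℕd≡i/ℕd+j : ∀ i j d .{{_ : NonZero d}} → (i + j * + d) /ℕ d ≡ i /ℕ d + j
[i+j*d]/ℕd≡i/ℕd+j i j d = /ℕ-unique (n%ℕd<d i d) (begin
  i + j * + d                                  ≡⟨ cong (_+ j * + d) (a≡a%ℕn+[a/ℕn]*n i d) ⟩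
  + (i %ℕ d) + (i /ℕ d) * + d + j * + d        ≡⟨ regroup (+ (i %ℕ d)) (i /ℕ d) j (+ d) ⟩
  + (i %ℕ d) + (i /ℕ d + j) * + d              ∎)
  where
  open ≡-Reasoning
  regroup : ∀ s x y e → s + x * e + y * e ≡ s + (x + y) * e
  regroup = solve-∀

neg1^-periodic : ∀ a k → neg1^ (a ℕ.+ k ℕ.* 2) ≡ neg1^ a
neg1^-periodic (suc a) k = cong -_ (neg1^-periodic a k)
neg1^-periodic zero zero = refl
neg1^-periodic zero (suc k) = trans (ℤ.neg-involutive _) (neg1^-periodic zero k)

χ₄ : ℕ → ℤ
χ₄ q = neg1^ ((q ℕ.∸ 1) ℕ./ 2)

χ₄-periodic : ∀ {r} L → 1 ≤ r → χ₄ (r ℕ.+ L ℕ.* 4) ≡ χ₄ r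
χ₄-periodic {r} L 1≤r = trans (cong neg1^ half-shift) (neg1^-periodic ((r ℕ.∸ 1) ℕ./ 2) L)
  where
  open ≡-Reasoning
  half-shift : (r ℕ.+ L ℕ.* 4 ℕ.∸ 1) ℕ./ 2 ≡ (r ℕ.∸ 1) ℕ./ 2 ℕ.+ L ℕ.* 2
  half-shift = begin
    (r ℕ.+ L ℕ.* 4 ℕ.∸ 1) ℕ./ 2         ≡⟨ cong (ℕ._/ 2) (ℕ.+-∸-comm (L ℕ.* 4) 1≤r) ⟩
    (r ℕ.∸ 1 ℕ.+ L ℕ.* 4) ℕ./ 2         ≡⟨ cong (λ x → (r ℕ.∸ 1 ℕ.+ x) ℕ./ 2) (ℕ.*-assoc L 2 2) ⟨
    (r ℕ.∸ 1 ℕ.+ L ℕ.* 2 ℕ.* 2) ℕ./ 2   ≡⟨ ℕ.+-distrib-/-∣ʳ (r ℕ.∸ 1) (ℕ.divides (L ℕ.* 2) refl) ⟩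
    (r ℕ.∸ 1) ℕ./ 2 ℕ.+ L ℕ.* 2 ℕ.* 2 ℕ./ 2 ≡⟨ cong ((r ℕ.∸ 1) ℕ./ 2 ℕ.+_) (ℕ.m*n/n≡m (L ℕ.* 2) 2) ⟩
    (r ℕ.∸ 1) ℕ./ 2 ℕ.+ L ℕ.* 2         ∎

u-shift : ∀ {r} L j → 1 ≤ r → u (r ℕ.+ L ℕ.* 4) j ≡ u r j - χ₄ r * + L * neg1^ j
u-shift {r} L j 1≤r = begin
  (+ (3 ℕ.^ j) - χ₄ (r ℕ.+ L ℕ.* 4) * + (r ℕ.+ L ℕ.* 4) * neg1^ j) /ℕ 4
    ≡⟨ cong₂ (λ c x → (+ (3 ℕ.^ j) - c * x * neg1^ j) /ℕ 4) (χ₄-periodic L 1≤r) pos-split ⟩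
  (+ (3 ℕ.^ j) - χ₄ r * (+ r + + L * + 4) * neg1^ j) /ℕ 4
    ≡⟨ cong (_/ℕ 4) (regroup (+ (3 ℕ.^ j)) (χ₄ r) (+ r) (+ L) (neg1^ j)) ⟩
  ((+ (3 ℕ.^ j) - χ₄ r * + r * neg1^ j) + - (χ₄ r * + L * neg1^ j) * + 4) /ℕ 4
    ≡⟨ [i+j*d]/ℕd≡i/ℕd+j (+ (3 ℕ.^ j) - χ₄ r * + r * neg1^ j) (- (χ₄ r * + L * neg1^ j)) 4 ⟩
  u r j - χ₄ r * + L * neg1^ j
    ∎
  where
  open ≡-Reasoning
  pos-split : + (r ℕ.+ L ℕ.* 4) ≡ + r + + L * + 4
  pos-split = trans (ℤ.pos-+ r (L ℕ.* 4)) (cong (_+_ (+ r)) (ℤ.pos-* L 4))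
  regroup : ∀ a c x y e → a - c * (x + y * + 4) * e ≡ (a - c * x * e) + - (c * y * e) * + 4
  regroup = solve-∀

u-diff-shift : ∀ {r} L i j → 1 ≤ r →
  u (r ℕ.+ L ℕ.* 4) i - u (r ℕ.+ L ℕ.* 4) j ≡ (u r i - u r j) + χ₄ r * (neg1^ j - neg1^ i) * + L
u-diff-shift {r} L i j 1≤r = begin
  u (r ℕ.+ L ℕ.* 4) i - u (r ℕ.+ L ℕ.* 4) j
    ≡⟨ cong₂ _-_ (u-shift L i 1≤r) (u-shift L j 1≤r) ⟩
  (u r i - χ₄ r * + L * neg1^ i) - (u r j - χ₄ r * + L * neg1^ j)
    ≡⟨ regroup (u r i) (u r j) (χ₄ r) (+ L) (neg1^ i) (neg1^ j) ⟩
  (u r i - u r j) + χ₄ r * (neg1^ j - neg1^ i) * + L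
    ∎
  where
  open ≡-Reasoning
  regroup : ∀ a b c l x y → (a - c * l * x) - (b - c * l * y) ≡ (a - b) + c * (y - x) * l
  regroup = solve-∀

∣-+-invariant : ∀ {k i j} → k Signed.∣ j → (k ∣ i + j) ⇔ (k ∣ i)
∣-+-invariant {k} {i} {j} k∣j = mk⇔
  (λ k∣i+j → Signed.∣⇒∣ᵤ (Signed.∣m+n∣n⇒∣m {k} {i} {j} (Signed.∣ᵤ⇒∣ k∣i+j) k∣j))
  (λ k∣i → Signed.∣⇒∣ᵤ (Signed.∣m∣n⇒∣m+n {k} {i} {j} (Signed.∣ᵤ⇒∣ k∣i) k∣j))

u-diff-shift-∣ : ∀ {r m} L i j → 1 ≤ r → m ℕ.∣ L →
  (+ m ∣ u (r ℕ.+ L ℕ.* 4) i - u (r ℕ.+ L ℕ.* 4) j) ⇔ (+ m ∣ u r i - u r j)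
u-diff-shift-∣ {r} {m} L i j 1≤r m∣L =
  subst (λ x → (+ m ∣ x) ⇔ (+ m ∣ u r i - u r j)) (sym (u-diff-shift L i j 1≤r))
    (∣-+-invariant {+ m} {u r i - u r j} {χ₄ r * (neg1^ j - neg1^ i) * + L}
      (Signed.∣n⇒∣m*n (χ₄ r * (neg1^ j - neg1^ i)) (Signed.∣ᵤ⇒∣ m∣L)))

Incongruent-cong : ∀ {q r n m} → (∀ i j → (+ m ∣ u q i - u q j) ⇔ (+ m ∣ u r i - u r j)) →
  Incongruent q n m ⇔ Incongruent r n m
Incongruent-cong same = mk⇔
  (λ inc i j 1≤i i≤n 1≤j j≤n m∣ → inc i j 1≤i i≤n 1≤j j≤n (from (same i j) m∣))
  (λ inc i j 1≤i i≤n 1≤j j≤n m∣ → inc i j 1≤i i≤n 1≤j j≤n (to (same i j) m∣))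

%[m*4]-odd : ∀ q m .{{_ : NonZero (m ℕ.* 4)}} → q % 2 ≢ 0 → q % (m ℕ.* 4) % 2 ≢ 0
%[m*4]-odd q m q-odd = q-odd ∘ trans (sym (ℕ.m∣n⇒o%n%m≡o%m 2 (m ℕ.* 4) q 2∣m*4))
  where
  2∣m*4 : 2 ℕ.∣ m ℕ.* 4
  2∣m*4 = ℕ.∣-trans (ℕ.divides {2} {4} 2 refl) (ℕ.n∣m*n m)

Incongruent-mod : ∀ q {n} m .{{_ : NonZero (m ℕ.* 4)}} → q % 2 ≢ 0 →
  Incongruent q n m ⇔ Incongruent (q % (m ℕ.* 4)) n m
Incongruent-mod q {n} m q-odd =
  subst (λ x → Incongruent x n m ⇔ Incongruent r n m) (sym q≡r+L*4)
    (Incongruent-cong {r ℕ.+ L ℕ.* 4} {r} {n} {m} (λ i j → u-diff-shift-∣ {r} {m} L i j 1≤r (ℕ.m∣m*n t)))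
  where
  r t L : ℕ
  r = q % (m ℕ.* 4)
  t = q ℕ./ (m ℕ.* 4)
  L = m ℕ.* t

  q≡r+L*4 : q ≡ r ℕ.+ L ℕ.* 4
  q≡r+L*4 = trans (ℕ.m≡m%n+[m/n]*n q (m ℕ.* 4)) (cong (r ℕ.+_) (regroup t m))
    where
    regroup : ∀ t m → t ℕ.* (m ℕ.* 4) ≡ m ℕ.* t ℕ.* 4
    regroup = ℕ-Solver.solve-∀

  1≤r : 1 ≤ r
  1≤r = ℕ.n≢0⇒n>0 (%[m*4]-odd q m q-odd ∘ cong (_% 2))

Incongruent? : ∀ q n m → Dec (Incongruent q n m)
Incongruent? q n m = map′ unbounded bounded
  (ℕ.allUpTo? (λ i → 1 ℕ.≤? i →-dec
     ℕ.allUpTo? (λ j → 1 ℕ.≤? j →-dec (m ℕ.∣? ∣ u q i - u q j ∣) →-dec (i ℕ.≟ j)) (suc n)) (suc n))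
  where
  Bounded : Set
  Bounded = ∀ {i} → i < suc n → 1 ≤ i → ∀ {j} → j < suc n → 1 ≤ j → + m ∣ u q i - u q j → i ≡ j
  unbounded : Bounded → Incongruent q n m
  unbounded h i j 1≤i i≤n 1≤j j≤n = h (s≤s i≤n) 1≤i (s≤s j≤n) 1≤j
  bounded : Incongruent q n m → Bounded
  bounded h (s≤s i≤n) 1≤i (s≤s j≤n) 1≤j = h _ _ 1≤i i≤n 1≤j j≤n

Incongruent-mono : ∀ q {n n′ m} → n ≤ n′ → Incongruent q n′ m → Incongruent q n m
Incongruent-mono q n≤n′ inc i j 1≤i i≤n 1≤j j≤n = inc i j 1≤i (ℕ.≤-trans i≤n n≤n′) 1≤j (ℕ.≤-trans j≤n n≤n′)

Odd? : ∀ r → Dec (r % 2 ≢ 0)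
Odd? r = ¬? (r % 2 ℕ.≟ 0)

residues-collide-mod-≤6 : ∀ {m} → m < 7 → 1 ≤ m → ∀ {r} → r < m ℕ.* 4 → r % 2 ≢ 0 → ¬ Incongruent r 5 m
residues-collide-mod-≤6 = from-yes (ℕ.allUpTo? (λ m → 1 ℕ.≤? m →-dec
  ℕ.allUpTo? (λ r → Odd? r →-dec ¬? (Incongruent? r 5 m)) (m ℕ.* 4)) 7)

residues-incongruent-mod-28 : ∀ {r} → r < 28 → r % 2 ≢ 0 → r ≡ 1 ⊎ r ≡ 27 → Incongruent r 5 7
residues-incongruent-mod-28 = from-yes (ℕ.allUpTo? (λ r →
  Odd? r →-dec (r ℕ.≟ 1 ⊎-dec r ℕ.≟ 27) →-dec Incongruent? r 5 7) 28)

residues-collide-mod-28 : ∀ {r} → r < 28 → r % 2 ≢ 0 → r % 7 ≢ 0 → ¬ (r ≡ 1 ⊎ r ≡ 27) → ¬ Incongruent r 5 7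
residues-collide-mod-28 = from-yes (ℕ.allUpTo? (λ r →
  Odd? r →-dec ¬? (r % 7 ℕ.≟ 0) →-dec ¬? (r ℕ.≟ 1 ⊎-dec r ℕ.≟ 27) →-dec ¬? (Incongruent? r 5 7)) 28)

residues-collide-6-mod-28 : ∀ {r} → r < 28 → r % 2 ≢ 0 → r % 7 ≢ 0 → ¬ Incongruent r 6 7
residues-collide-6-mod-28 = from-yes (ℕ.allUpTo? (λ r →
  Odd? r →-dec ¬? (r % 7 ℕ.≟ 0) →-dec ¬? (Incongruent? r 6 7)) 28)

residues-incongruent-mod-32 : ∀ {r} → r < 32 → r % 2 ≢ 0 → Incongruent r 6 8
residues-incongruent-mod-32 = from-yes (ℕ.allUpTo? (λ r → Odd? r →-dec Incongruent? r 6 8) 32)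

Incongruent-7-6-7 : Incongruent 7 6 7
Incongruent-7-6-7 = from-yes (Incongruent? 7 6 7)

collides-mod-≤6 : ∀ q {n m} → q % 2 ≢ 0 → 5 ≤ n → 1 ≤ m → m < 7 → ¬ Incongruent q n m
collides-mod-≤6 q {n} {m} q-odd 5≤n 1≤m m<7 =
  residues-collide-mod-≤6 m<7 1≤m (ℕ.m%n<n q (m ℕ.* 4)) (%[m*4]-odd q m q-odd)
    ∘ to (Incongruent-mod q m q-odd) ∘ Incongruent-mono q 5≤n
  where instance _ = ℕ.m*n≢0 m 4 {{ℕ.>-nonZero 1≤m}}

incongruent-mod-8 : ∀ q {n} → q % 2 ≢ 0 → n ≤ 6 → Incongruent q n 8
incongruent-mod-8 q q-odd n≤6 = Incongruent-mono q n≤6 (from (Incongruent-mod q 8 q-odd)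
  (residues-incongruent-mod-32 (ℕ.m%n<n q 32) (%[m*4]-odd q 8 q-odd)))

%28-%7≢0 : ∀ q → q % 7 ≢ 0 → q % 28 % 7 ≢ 0
%28-%7≢0 q q%7≢0 = q%7≢0 ∘ trans (sym (ℕ.m∣n⇒o%n%m≡o%m 7 28 q (ℕ.divides 4 refl)))

incongruent-mod-28 : ∀ q → q % 2 ≢ 0 → q % 28 ≡ 1 ⊎ q % 28 ≡ 27 → Incongruent q 5 7
incongruent-mod-28 q q-odd = from (Incongruent-mod q 7 q-odd)
  ∘ residues-incongruent-mod-28 (ℕ.m%n<n q 28) (%[m*4]-odd q 7 q-odd)

collides-mod-28 : ∀ q → q % 2 ≢ 0 → q % 7 ≢ 0 → ¬ (q % 28 ≡ 1 ⊎ q % 28 ≡ 27) → ¬ Incongruent q 5 7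
collides-mod-28 q q-odd q%7≢0 ¬±1 =
  residues-collide-mod-28 (ℕ.m%n<n q 28) (%[m*4]-odd q 7 q-odd) (%28-%7≢0 q q%7≢0) ¬±1
    ∘ to (Incongruent-mod q 7 q-odd)

collides-6-mod-28 : ∀ q → q % 2 ≢ 0 → q % 7 ≢ 0 → ¬ Incongruent q 6 7
collides-6-mod-28 q q-odd q%7≢0 =
  residues-collide-6-mod-28 (ℕ.m%n<n q 28) (%[m*4]-odd q 7 q-odd) (%28-%7≢0 q q%7≢0)
    ∘ to (Incongruent-mod q 7 q-odd)

IsD-7 : ∀ q {n} → q % 2 ≢ 0 → 5 ≤ n → Incongruent q n 7 → IsD q n 7
IsD-7 q q-odd 5≤n inc = s≤s z≤n , inc , λ k 1≤k k<7 → collides-mod-≤6 q q-odd 5≤n 1≤k k<7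

IsD-8 : ∀ q {n} → q % 2 ≢ 0 → 5 ≤ n → n ≤ 6 → ¬ Incongruent q n 7 → IsD q n 8
IsD-8 q {n} q-odd 5≤n n≤6 ¬inc₇ = s≤s z≤n , incongruent-mod-8 q q-odd n≤6 , collides-below-8
  where
  collides-below-8 : ∀ k → 1 ≤ k → k < 8 → ¬ Incongruent q n k
  collides-below-8 k 1≤k (s≤s k≤7) with ℕ.m≤n⇒m<n∨m≡n k≤7
  ... | inj₁ k<7 = collides-mod-≤6 q q-odd 5≤n 1≤k k<7
  ... | inj₂ refl = ¬inc₇

prime⇒%≢0 : ∀ {p} d .{{_ : NonZero d}} → Prime p → 1 < d → d ≢ p → p % d ≢ 0
prime⇒%≢0 {p} d pr 1<d d≢p p%d≡0 with prime⇒irreducible pr (ℕ.m%n≡0⇒n∣m p d p%d≡0)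
... | inj₁ d≡1 = ℕ.<-irrefl (sym d≡1) 1<d
... | inj₂ d≡p = d≢p d≡p

lemma31 : (q : ℕ) → Prime q → 5 ≤ q →
    ((q ≡ 7 ⊎ q % 28 ≡ 1 ⊎ q % 28 ≡ 27) → IsD q 5 7)
    × (¬ (q ≡ 7 ⊎ q % 28 ≡ 1 ⊎ q % 28 ≡ 27) → IsD q 5 8)
    × (q ≡ 7 → IsD q 6 7)
    × (q ≢ 7 → IsD q 6 8)
lemma31 q pr 5≤q = D₅≡7 , D₅≡8 , D₆≡7 , D₆≡8
  where
  q-odd : q % 2 ≢ 0
  q-odd = prime⇒%≢0 2 pr (s≤s (s≤s z≤n)) (ℕ.<⇒≢ (ℕ.<-≤-trans (s≤s (s≤s (s≤s z≤n))) 5≤q))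

  q%7≢0 : q ≢ 7 → q % 7 ≢ 0
  q%7≢0 q≢7 = prime⇒%≢0 7 pr (s≤s (s≤s z≤n)) (q≢7 ∘ sym)

  incongruent-7 : ∀ {n} → n ≤ 6 → q ≡ 7 → Incongruent q n 7
  incongruent-7 n≤6 q≡7 = subst (λ x → Incongruent x _ 7) (sym q≡7) (Incongruent-mono 7 n≤6 Incongruent-7-6-7)

  D₅≡7 : q ≡ 7 ⊎ q % 28 ≡ 1 ⊎ q % 28 ≡ 27 → IsD q 5 7
  D₅≡7 (inj₁ q≡7) = IsD-7 q q-odd ℕ.≤-refl (incongruent-7 (ℕ.n≤1+n 5) q≡7)
  D₅≡7 (inj₂ ±1) = IsD-7 q q-odd ℕ.≤-refl (incongruent-mod-28 q q-odd ±1)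

  D₅≡8 : ¬ (q ≡ 7 ⊎ q % 28 ≡ 1 ⊎ q % 28 ≡ 27) → IsD q 5 8
  D₅≡8 ¬c = IsD-8 q q-odd ℕ.≤-refl (ℕ.n≤1+n 5) (collides-mod-28 q q-odd (q%7≢0 (¬c ∘ inj₁)) (¬c ∘ inj₂))

  D₆≡7 : q ≡ 7 → IsD q 6 7
  D₆≡7 = IsD-7 q q-odd (ℕ.n≤1+n 5) ∘ incongruent-7 ℕ.≤-refl

  D₆≡8 : q ≢ 7 → IsD q 6 8
  D₆≡8 = IsD-8 q q-odd (ℕ.n≤1+n 5) ℕ.≤-refl ∘ collides-6-mod-28 q q-odd ∘ q%7≢0
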